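{- Let $G=(S,T;E)$ with $S=\{s_1,\dots,s_n\}$, $d\in\mathbb Z_+$ with $n\ge d$, and $r\in\mathbb Z_+$, $r\ge1$. Suppose the instance is $r$-regular: $\deg(s)=r$ for every $s\in S$, and for every $t\in T$ and every $i=1,\dots,n-d+1$ the number of edges between $t$ and $\{s_i,\dots,s_{i+d-1}\}$ is exactly $r$. Then $E$ can be partitioned into $r$ perfect $d$-distance matchings.
   Context: $G$ is a finite bipartite graph without loops or parallel edges; the nodes of $S$ are in the fixed order $s_1,\dots,s_n$. A $d$-distance matching is a subset $M\subseteq E$ such that every node of $S$ is incident to at most one edge of $M$, and whenever $s_it,s_jt\in M$ with $i\ne j$, $t\in T$, we have $|j-i|\ge d$; it is perfect if every node of $S$ is incident to exactly one edge of $M$. -}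

module Defs where

open import Data.Nat using (ℕ; zero; suc; _+_; _≤_; _<_; _≥_; _∸_)
open import Data.Nat.Base using (∣_-_∣)
open import Data.Bool using (Bool; true; false; if_then_else_; _∧_)
open import Data.Fin using (Fin; toℕ)
import Data.Fin as Fin
open import Data.Product using (Σ; _×_; _,_)
open import Relation.Binary.PropositionalEquality using (_≡_; _≢_)

open import Data.Nat using (_≤ᵇ_; _<ᵇ_)

count : ∀ {k} → (Fin k → Bool) → ℕ
count {zero}  f = 0
count {suc k} f = (if f Fin.zero then 1 else 0) + count (λ i → f (Fin.suc i))

-- A bipartite graph G = (S, T; E) with S = {s_0,…,s_{n-1}} (in this order)
-- and T = Fin m, given by its (simple) edge relation.
BipGraph : ℕ → ℕ → Set
BipGraph n m = Fin n → Fin m → Bool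

deg : ∀ {n m} → BipGraph n m → Fin n → ℕ
deg E s = count (λ t → E s t)

-- number of edges between t and {s_i, …, s_{i+d-1}}  (0-based i)
windowDeg : ∀ {n m} → BipGraph n m → ℕ → ℕ → Fin m → ℕ
windowDeg E d i t = count (λ s → ((i ≤ᵇ toℕ s) ∧ (toℕ s <ᵇ i + d)) ∧ E s t)

IsRegular : ∀ {n m} → BipGraph n m → ℕ → ℕ → Set
IsRegular {n} {m} E d r =
  (∀ s → deg E s ≡ r) ×
  (∀ (t : Fin m) (i : ℕ) → i + d ≤ n → windowDeg E d i t ≡ r)

EdgeSet : ℕ → ℕ → Set
EdgeSet n m = Fin n → Fin m → Bool

_⊆E_ : ∀ {n m} → EdgeSet n m → BipGraph n m → Set
M ⊆E E = ∀ s t → M s t ≡ true → E s t ≡ true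

IsPerfectDMatching : ∀ {n m} → ℕ → EdgeSet n m → Set
IsPerfectDMatching {n} {m} d M =
  (∀ s → count (λ t → M s t) ≡ 1) ×
  (∀ (s s' : Fin n) (t : Fin m) → M s t ≡ true → M s' t ≡ true → s ≢ s' →
     ∣ toℕ s - toℕ s' ∣ ≥ d)

PartitionInto : ∀ {n m} → ℕ → (r : ℕ) → BipGraph n m → Set
PartitionInto {n} {m} d r E =
  Σ (Fin r → EdgeSet n m) λ M →
    (∀ k → M k ⊆E E) ×
    (∀ s t → E s t ≡ true → count (λ k → M k s t) ≡ 1) ×
    (∀ k → IsPerfectDMatching d (M k))

-- Sliding a window from {s_i,…,s_{i+d-1}} to {s_{i+1},…,s_{i+d}} loses s_i and gains s_{i+d};
-- as both windows send exactly r edges to t, s_i t ∈ E iff s_{i+d} t ∈ E.  So E is periodic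
-- with period d along S: s t ∈ E iff s' t ∈ E, where s' is the node among s_1,…,s_d with
-- the same index modulo d.  The graph H spanned by s_1,…,s_d and T is r-regular on both sides,
-- hence (König; here derived from Hall's theorem, proved by Rado's edge-deletion argument)
-- a disjoint union of r perfect matchings.  Pulling each of them back along the residue map
-- gives a perfect matching of E in which two nodes with a common partner have the same
-- index modulo d, hence are at distance at least d.
module Submission where

open import Defs
open import Data.Nat using (ℕ; _≤_; _≥_)
open import Data.Nat.Base using (zero; suc; _+_; _*_; _∸_; _<_; z≤n; s≤s; s≤s⁻¹; _≤ᵇ_; _<ᵇ_; ∣_-_∣; NonZero; ≢-nonZero)
open import Data.Nat.Properties
  using ( _≤?_; _<?_; ≤-refl; ≤-reflexive; ≤-trans; ≤-total; <⇒≤; <⇒≱; ≰⇒>; ≮⇒≥; >⇒≢; 1+n≰n; n<1+n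
        ; ≤-<-trans; <-≤-trans; m≤m+n; suc-injective; +-identityʳ; +-comm; +-assoc; +-suc; +-cancelˡ-≡
        ; +-mono-≤; +-mono-<-≤; +-mono-≤-<; *-identityˡ; *-cancelʳ-≤; *-distribʳ-∸; [m+n]∸[m+o]≡n∸o
        ; m≤n⇒∣m-n∣≡n∸m; m≤n⇒∣n-m∣≡n∸m; ∣m-n∣≡0⇒m≡n; +-*-semiring; module ≤-Reasoning )
open import Data.Nat.DivMod using (_%_; _/_; _mod_; m≡m%n+[m/n]*n)
open import Data.Nat.Divisibility using (_∣_; divides; ∣⇒≤)
open import Data.Bool.Base using (Bool; true; false; if_then_else_; _∧_; _∨_; not)
import Data.Bool.Properties as Bool
open import Data.Fin.Base using (Fin; toℕ; inject≤; punchOut)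
import Data.Fin.Base as Fin
open import Data.Fin.Properties
  using (_≟_; any?; toℕ-injective; toℕ-inject≤; toℕ-fromℕ<; toℕ<n; injective⇒≤; punchOut-injective)
open import Data.Fin.Subset.Properties using (anySubset?)
open import Data.Vec.Base using (lookup; tabulate)
open import Data.Vec.Properties using (lookup∘tabulate)
open import Data.Product.Base using (∃; ∃-syntax; _×_; _,_; proj₁; proj₂)
open import Data.Sum.Base using (_⊎_; inj₁; inj₂)
open import Data.Empty using (⊥; ⊥-elim)
open import Function.Base using (_∘_)
open import Function.Definitions using (Injective)
open import Relation.Nullary using (¬_; yes; no; does; contradiction)
open import Relation.Nullary.Decidable using (dec-true; dec-false)
open import Relation.Binary.PropositionalEquality
  using (_≡_; _≢_; _≗_; refl; sym; trans; cong; cong₂; subst; subst₂; module ≡-Reasoning)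
open import Algebra.Properties.Semiring.Sum +-*-semiring using (sum; sum-cong-≗; ∑-comm; ∑-distrib-+; *-distribʳ-sum)

ind : Bool → ℕ
ind b = if b then 1 else 0

ind-injective : ∀ {a b} → ind a ≡ ind b → a ≡ b
ind-injective {false} {false} _ = refl
ind-injective {true}  {true}  _ = refl

ind-mono : ∀ {a b} → (a ≡ true → b ≡ true) → ind a ≤ ind b
ind-mono {false} _ = z≤n
ind-mono {true}  a⇒b rewrite a⇒b refl = ≤-refl

ind-∨-∧ : ∀ a b → ind (a ∨ b) + ind (a ∧ b) ≡ ind a + ind b
ind-∨-∧ true  true  = refl
ind-∨-∧ true  false = refl
ind-∨-∧ false true  = refl
ind-∨-∧ false false = refl

∨-true : ∀ a b → a ∨ b ≡ true → a ≡ true ⊎ b ≡ true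
∨-true true  b _ = inj₁ refl
∨-true false b p = inj₂ p

bool-antisym : ∀ {a b} → (a ≡ true → b ≡ true) → (b ≡ true → a ≡ true) → a ≡ b
bool-antisym {false} {false} _   _   = refl
bool-antisym {false} {true}  _   b⇒a = b⇒a refl
bool-antisym {true}          a⇒b _   = sym (a⇒b refl)

_==_ : ∀ {k} → Fin k → Fin k → Bool
i == j = does (i ≟ j)

==-refl : ∀ {k} (i : Fin k) → (i == i) ≡ true
==-refl i = dec-true (i ≟ i) refl

≡⇒== : ∀ {k} {i j : Fin k} → i ≡ j → (i == j) ≡ true
≡⇒== {i = i} refl = ==-refl i

==⇒≡ : ∀ {k} {i j : Fin k} → (i == j) ≡ true → i ≡ j
==⇒≡ {i = i} {j} eq with i ≟ j
... | yes i≡j = i≡j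

≢⇒==false : ∀ {k} {i j : Fin k} → i ≢ j → (i == j) ≡ false
≢⇒==false {i = i} {j} = dec-false (i ≟ j)

infixl 6 _∖_
infixr 6 _∩_
infixr 5 _∪_
infix 4 _⊆_

_∖_ : ∀ {k} → (Fin k → Bool) → Fin k → Fin k → Bool
(X ∖ x) i = not (i == x) ∧ X i

_∪_ _∩_ : ∀ {k} → (Fin k → Bool) → (Fin k → Bool) → Fin k → Bool
(X ∪ Y) i = X i ∨ Y i
(X ∩ Y) i = X i ∧ Y i

_⊆_ : ∀ {k} → (Fin k → Bool) → (Fin k → Bool) → Set
X ⊆ Y = ∀ i → X i ≡ true → Y i ≡ true

∖-intro : ∀ {k} {X : Fin k → Bool} {x i} → i ≢ x → X i ≡ true → (X ∖ x) i ≡ true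
∖-intro i≢x Xi = cong₂ _∧_ (cong not (≢⇒==false i≢x)) Xi

∖-elim : ∀ {k} {X : Fin k → Bool} {x i} → (X ∖ x) i ≡ true → i ≢ x × X i ≡ true
∖-elim {x = x} {i} X∖xi with i ≟ x
... | no i≢x = i≢x , X∖xi

∪-introˡ : ∀ {k} {X Y : Fin k → Bool} {i} → X i ≡ true → (X ∪ Y) i ≡ true
∪-introˡ {Y = Y} {i} Xi = cong (_∨ Y i) Xi

∪-introʳ : ∀ {k} {X Y : Fin k → Bool} {i} → Y i ≡ true → (X ∪ Y) i ≡ true
∪-introʳ {X = X} {i = i} Yi = trans (cong (X i ∨_) Yi) (Bool.∨-zeroʳ (X i))

count-cong : ∀ {k} {X Y : Fin k → Bool} → X ≗ Y → count X ≡ count Y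
count-cong {zero}  _   = refl
count-cong {suc k} X≗Y = cong₂ _+_ (cong ind (X≗Y Fin.zero)) (count-cong (X≗Y ∘ Fin.suc))

count≡sum : ∀ {k} (X : Fin k → Bool) → count X ≡ sum (ind ∘ X)
count≡sum {zero}  X = refl
count≡sum {suc k} X = cong (ind (X Fin.zero) +_) (count≡sum (X ∘ Fin.suc))

count-none : ∀ {k} {X : Fin k → Bool} → (∀ i → X i ≡ false) → count X ≡ 0
count-none {zero}  _         = refl
count-none {suc k} X≡false rewrite X≡false Fin.zero = count-none (X≡false ∘ Fin.suc)

count-mono : ∀ {k} {X Y : Fin k → Bool} → X ⊆ Y → count X ≤ count Y
count-mono {zero}  _   = z≤n
count-mono {suc k} X⊆Y = +-mono-≤ (ind-mono (X⊆Y Fin.zero)) (count-mono (X⊆Y ∘ Fin.suc))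

count-∪-∩ : ∀ {k} (X Y : Fin k → Bool) → count (X ∪ Y) + count (X ∩ Y) ≡ count X + count Y
count-∪-∩ X Y = begin
  count (X ∪ Y) + count (X ∩ Y)                  ≡⟨ cong₂ _+_ (count≡sum (X ∪ Y)) (count≡sum (X ∩ Y)) ⟩
  sum (ind ∘ (X ∪ Y)) + sum (ind ∘ (X ∩ Y))      ≡⟨ ∑-distrib-+ (ind ∘ (X ∪ Y)) (ind ∘ (X ∩ Y)) ⟨
  sum (λ i → ind ((X ∪ Y) i) + ind ((X ∩ Y) i))  ≡⟨ sum-cong-≗ (λ i → ind-∨-∧ (X i) (Y i)) ⟩
  sum (λ i → ind (X i) + ind (Y i))              ≡⟨ ∑-distrib-+ (ind ∘ X) (ind ∘ Y) ⟩
  sum (ind ∘ X) + sum (ind ∘ Y)                  ≡⟨ cong₂ _+_ (count≡sum X) (count≡sum Y) ⟨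
  count X + count Y                              ∎
  where open ≡-Reasoning

count-remove : ∀ {k} (X : Fin k → Bool) x → count X ≡ count (X ∖ x) + ind (X x)
count-remove {suc k} X Fin.zero    = +-comm (ind (X Fin.zero)) _
count-remove {suc k} X (Fin.suc x) = begin
  ind (X Fin.zero) + count (X ∘ Fin.suc)                                ≡⟨ cong (ind (X Fin.zero) +_) (count-remove (X ∘ Fin.suc) x) ⟩
  ind (X Fin.zero) + (count ((X ∘ Fin.suc) ∖ x) + ind (X (Fin.suc x)))  ≡⟨ +-assoc (ind (X Fin.zero)) _ _ ⟨
  ind (X Fin.zero) + count ((X ∘ Fin.suc) ∖ x) + ind (X (Fin.suc x))    ∎
  where open ≡-Reasoning

count-remove-∈ : ∀ {k} (X : Fin k → Bool) {x} → X x ≡ true → count X ≡ suc (count (X ∖ x))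
count-remove-∈ X {x} Xx = begin
  count X                    ≡⟨ count-remove X x ⟩
  count (X ∖ x) + ind (X x)  ≡⟨ cong (λ b → count (X ∖ x) + ind b) Xx ⟩
  count (X ∖ x) + 1          ≡⟨ +-comm (count (X ∖ x)) 1 ⟩
  suc (count (X ∖ x))        ∎
  where open ≡-Reasoning

count-pos : ∀ {k} {X : Fin k → Bool} {i} → X i ≡ true → 0 < count X
count-pos {X = X} Xi = subst (0 <_) (sym (count-remove-∈ X Xi)) (s≤s z≤n)

count-singleton : ∀ {k} (x : Fin k) → count (_== x) ≡ 1
count-singleton x = trans (count-remove-∈ (_== x) (==-refl x)) (cong suc (count-none λ i → Bool.∧-inverseˡ (i == x)))

count-witness : ∀ {k} {X : Fin k → Bool} → 0 < count X → ∃ λ i → X i ≡ true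
count-witness {suc k} {X} pos with X Fin.zero in X0
... | true  = Fin.zero , X0
... | false = let i , Xi = count-witness {X = X ∘ Fin.suc} pos in Fin.suc i , Xi

count-pair : ∀ {k} {X : Fin k → Bool} {i j} → i ≢ j → X i ≡ true → X j ≡ true → 2 ≤ count X
count-pair {X = X} {i} {j} i≢j Xi Xj =
  subst (2 ≤_) (sym (count-remove-∈ X Xj)) (s≤s (count-pos {X = X ∖ j} {i} (∖-intro {X = X} i≢j Xi)))

count≤1⇒unique : ∀ {k} {X : Fin k → Bool} → count X ≤ 1 → ∀ {i j} → X i ≡ true → X j ≡ true → i ≡ j
count≤1⇒unique ≤1 {i} {j} Xi Xj with i ≟ j
... | yes i≡j = i≡j
... | no  i≢j = contradiction (≤-trans (count-pair i≢j Xi Xj) ≤1) (1+n≰n {1})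

count≥2⇒pair : ∀ {k} {X : Fin k → Bool} → 2 ≤ count X → ∃[ i ] ∃[ j ] i ≢ j × X i ≡ true × X j ≡ true
count≥2⇒pair {X = X} ≥2 =
  let i , Xi     = count-witness (≤-trans (s≤s z≤n) ≥2)
      j , X∖i-j  = count-witness {X = X ∖ i} (s≤s⁻¹ (subst (2 ≤_) (count-remove-∈ X Xi) ≥2))
      j≢i , Xj   = ∖-elim {X = X} X∖i-j
  in i , j , j≢i ∘ sym , Xi , Xj

sum-mono : ∀ {k} {f g : Fin k → ℕ} → (∀ i → f i ≤ g i) → sum f ≤ sum g
sum-mono {zero}  _   = z≤n
sum-mono {suc k} f≤g = +-mono-≤ (f≤g Fin.zero) (sum-mono (f≤g ∘ Fin.suc))

sum-mono-< : ∀ {k} {f g : Fin k → ℕ} → (∀ i → f i ≤ g i) → ∀ x → f x < g x → sum f < sum g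
sum-mono-< f≤g Fin.zero    fx<gx = +-mono-<-≤ fx<gx (sum-mono (f≤g ∘ Fin.suc))
sum-mono-< f≤g (Fin.suc x) fx<gx = +-mono-≤-< (f≤g Fin.zero) (sum-mono-< (f≤g ∘ Fin.suc) x fx<gx)

count-swap : ∀ {a b} (R : Fin a → Fin b → Bool) → sum (λ x → count (R x)) ≡ sum (λ y → count (λ x → R x y))
count-swap R = begin
  sum (λ x → count (R x))              ≡⟨ sum-cong-≗ (λ x → count≡sum (R x)) ⟩
  sum (λ x → sum (λ y → ind (R x y)))  ≡⟨ ∑-comm (λ x y → ind (R x y)) ⟩
  sum (λ y → sum (λ x → ind (R x y)))  ≡⟨ sum-cong-≗ (λ y → count≡sum (λ x → R x y)) ⟨
  sum (λ y → count (λ x → R x y))      ∎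
  where open ≡-Reasoning

injective⇒surjective : ∀ {a b} {f : Fin a → Fin b} → Injective _≡_ _≡_ f → b ≤ a → ∀ y → ∃ λ x → f x ≡ y
injective⇒surjective {a} {suc b} {f} f-injective b≤a y with any? (λ x → f x ≟ y)
... | yes hit  = hit
... | no  miss = contradiction (injective⇒≤ punchOut-f-injective) (<⇒≱ b≤a)
  where
    punchOut-f : Fin a → Fin b
    punchOut-f x = punchOut (miss ∘ (x ,_) ∘ sym)

    punchOut-f-injective : Injective _≡_ _≡_ punchOut-f
    punchOut-f-injective {x} {x′} = f-injective ∘ punchOut-injective (miss ∘ (x ,_) ∘ sym) (miss ∘ (x′ ,_) ∘ sym)

-- Hall's theorem

module _ {a b : ℕ} where

  codeg : BipGraph a b → Fin b → ℕ
  codeg E y = count (λ x → E x y)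

  edgeCount : BipGraph a b → ℕ
  edgeCount E = sum (deg E)

  -- Opaque, so that E and X can be inferred from the type neighbours E X y ≡ true.
  opaque
    neighbours : BipGraph a b → (Fin a → Bool) → Fin b → Bool
    neighbours E X y = does (any? λ x → X x ∧ E x y Bool.≟ true)

    neighbours-intro : ∀ {E X x y} → X x ≡ true → E x y ≡ true → neighbours E X y ≡ true
    neighbours-intro {x = x} Xx Exy = dec-true (any? _) (x , cong₂ _∧_ Xx Exy)

    neighbours-elim : ∀ {E X y} → neighbours E X y ≡ true → ∃ λ x → X x ≡ true × E x y ≡ true
    neighbours-elim {E} {X} {y} _ with any? (λ x → X x ∧ E x y Bool.≟ true)
    ... | yes (x , XEx) = x , Bool.∧-conicalˡ _ _ XEx , Bool.∧-conicalʳ _ _ XEx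

  neighbours-⊆ : ∀ {E X Z} → (∀ {x y} → X x ≡ true → E x y ≡ true → Z y ≡ true) → neighbours E X ⊆ Z
  neighbours-⊆ edge⇒Z y N = let _ , Xx , Exy = neighbours-elim N in edge⇒Z Xx Exy

  neighbours-cong : ∀ {E X Y} → X ≗ Y → neighbours E X ≗ neighbours E Y
  neighbours-cong X≗Y y = bool-antisym
    (neighbours-⊆ (λ Xx → neighbours-intro (trans (sym (X≗Y _)) Xx)) y)
    (neighbours-⊆ (λ Yx → neighbours-intro (trans (X≗Y _) Yx)) y)

  HallCondition : BipGraph a b → Set
  HallCondition E = ∀ X → count X ≤ count (neighbours E X)

  hall? : ∀ E → HallCondition E ⊎ ∃ λ X → count (neighbours E X) < count X
  hall? E with anySubset? (λ p → count (neighbours E (lookup p)) <? count (lookup p))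
  ... | yes (p , violated) = inj₂ (lookup p , violated)
  ... | no  ¬violated      = inj₁ λ X → ≮⇒≥ λ violated →
    let X≗X′ = λ i → sym (lookup∘tabulate X i)
    in ¬violated (tabulate X , subst₂ _<_ (count-cong (neighbours-cong X≗X′)) (count-cong X≗X′) violated)

  opaque
    deleteEdge : BipGraph a b → Fin a → Fin b → BipGraph a b
    deleteEdge E x y x′ y′ = not (x′ == x ∧ y′ == y) ∧ E x′ y′

    deleteEdge-⊆ : ∀ E x y → deleteEdge E x y ⊆E E
    deleteEdge-⊆ E x y x′ y′ = Bool.∧-conicalʳ _ _

    deleteEdge-keeps : ∀ {E x y x′ y′} → x′ ≢ x ⊎ y′ ≢ y → E x′ y′ ≡ true → deleteEdge E x y x′ y′ ≡ true
    deleteEdge-keeps (inj₁ x′≢x) e rewrite ≢⇒==false x′≢x = e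
    deleteEdge-keeps {x = x} {x′ = x′} (inj₂ y′≢y) e rewrite ≢⇒==false y′≢y | Bool.∧-zeroʳ (x′ == x) = e

    deleteEdge-row : ∀ E x y → deleteEdge E x y x ≗ E x ∖ y
    deleteEdge-row E x y y′ = cong (λ c → not (c ∧ (y′ == y)) ∧ E x y′) (==-refl x)

  edgeCount-deleteEdge : ∀ {E x y} → E x y ≡ true → edgeCount (deleteEdge E x y) < edgeCount E
  edgeCount-deleteEdge {E} {x} {y} Exy = sum-mono-< (λ x′ → count-mono (deleteEdge-⊆ E x y x′)) x (begin-strict
    deg (deleteEdge E x y) x  ≡⟨ count-cong (deleteEdge-row E x y) ⟩
    count (E x ∖ y)           <⟨ n<1+n _ ⟩
    suc (count (E x ∖ y))     ≡⟨ count-remove-∈ (E x) Exy ⟨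
    deg E x                   ∎)
    where open ≤-Reasoning

  record Matching (E : BipGraph a b) : Set where
    field
      mate           : Fin a → Fin b
      mate-edge      : ∀ x → E x (mate x) ≡ true
      mate-injective : Injective _≡_ _≡_ mate

  Matching-mono : ∀ {E F} → E ⊆E F → Matching E → Matching F
  Matching-mono E⊆F M = record
    { mate           = mate
    ; mate-edge      = λ x → E⊆F x (mate x) (mate-edge x)
    ; mate-injective = mate-injective
    }
    where open Matching M

  violator-contains : ∀ {E x y X} → HallCondition E → count (neighbours (deleteEdge E x y) X) < count X → X x ≡ true
  violator-contains {E} {x} {y} {X} hall violated with X x in Xx
  ... | true  = refl
  ... | false = contradiction (≤-trans (hall X) (count-mono N⊆N′)) (<⇒≱ violated)
    where
      N⊆N′ : neighbours E X ⊆ neighbours (deleteEdge E x y) X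
      N⊆N′ = neighbours-⊆ λ {x′} Xx′ Ex′y′ → neighbours-intro Xx′ (deleteEdge-keeps
        (inj₁ λ x′≡x → contradiction (trans (sym Xx′) (trans (cong X x′≡x) Xx)) λ ()) Ex′y′)

  -- Both violators X₁, X₂ contain x; Hall's condition for X₁ ∪ X₂ and for (X₁ ∩ X₂) ∖ x then
  -- gives |X₁| + |X₂| ≤ |N₁| + |N₂| + 1, contradicting |N₁| < |X₁| and |N₂| < |X₂|.
  no-two-violators : ∀ {E x y₁ y₂ X₁ X₂} → HallCondition E → y₁ ≢ y₂ →
                     count (neighbours (deleteEdge E x y₁) X₁) < count X₁ →
                     count (neighbours (deleteEdge E x y₂) X₂) < count X₂ → ⊥
  no-two-violators {E} {x} {y₁} {y₂} {X₁} {X₂} hall y₁≢y₂ v₁ v₂ = 1+n≰n (begin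
    suc (suc (count N₁ + count N₂))                ≡⟨ cong suc (+-suc (count N₁) (count N₂)) ⟨
    suc (count N₁) + suc (count N₂)                ≤⟨ +-mono-≤ v₁ v₂ ⟩
    count X₁ + count X₂                            ≡⟨ count-∪-∩ X₁ X₂ ⟨
    count (X₁ ∪ X₂) + count (X₁ ∩ X₂)              ≡⟨ cong (count (X₁ ∪ X₂) +_) (count-remove-∈ (X₁ ∩ X₂) x∈X₁∩X₂) ⟩
    count (X₁ ∪ X₂) + suc (count ((X₁ ∩ X₂) ∖ x))  ≤⟨ +-mono-≤ hall-∪ (s≤s hall-∩) ⟩
    count (N₁ ∪ N₂) + suc (count (N₁ ∩ N₂))        ≡⟨ +-suc _ _ ⟩
    suc (count (N₁ ∪ N₂) + count (N₁ ∩ N₂))        ≡⟨ cong suc (count-∪-∩ N₁ N₂) ⟩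
    suc (count N₁ + count N₂)                      ∎)
    where
      open ≤-Reasoning
      N₁ = neighbours (deleteEdge E x y₁) X₁
      N₂ = neighbours (deleteEdge E x y₂) X₂

      x∈X₁∩X₂ : (X₁ ∩ X₂) x ≡ true
      x∈X₁∩X₂ = cong₂ _∧_ (violator-contains hall v₁) (violator-contains hall v₂)

      in-N₁ : ∀ {x′ y} → X₁ x′ ≡ true → deleteEdge E x y₁ x′ y ≡ true → (N₁ ∪ N₂) y ≡ true
      in-N₁ X₁x′ e = ∪-introˡ {X = N₁} {N₂} (neighbours-intro X₁x′ e)

      in-N₂ : ∀ {x′ y} → X₂ x′ ≡ true → deleteEdge E x y₂ x′ y ≡ true → (N₁ ∪ N₂) y ≡ true
      in-N₂ X₂x′ e = ∪-introʳ {X = N₁} {N₂} (neighbours-intro X₂x′ e)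

      union-edge : ∀ {x′ y} → (X₁ ∪ X₂) x′ ≡ true → E x′ y ≡ true → (N₁ ∪ N₂) y ≡ true
      union-edge {x′} {y} X₁₂x′ Ex′y with x′ ≟ x | y ≟ y₁ | ∨-true (X₁ x′) (X₂ x′) X₁₂x′
      ... | no x′≢x  | _        | inj₁ X₁x′ = in-N₁ X₁x′ (deleteEdge-keeps (inj₁ x′≢x) Ex′y)
      ... | no x′≢x  | _        | inj₂ X₂x′ = in-N₂ X₂x′ (deleteEdge-keeps (inj₁ x′≢x) Ex′y)
      ... | yes refl | no y≢y₁  | _         = in-N₁ (Bool.∧-conicalˡ _ _ x∈X₁∩X₂) (deleteEdge-keeps (inj₂ y≢y₁) Ex′y)
      ... | yes refl | yes refl | _         = in-N₂ (Bool.∧-conicalʳ _ _ x∈X₁∩X₂) (deleteEdge-keeps (inj₂ y₁≢y₂) Ex′y)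

      inter-edge : ∀ {x′ y} → ((X₁ ∩ X₂) ∖ x) x′ ≡ true → E x′ y ≡ true → (N₁ ∩ N₂) y ≡ true
      inter-edge X∖x Ex′y =
        let x′≢x , X₁₂x′ = ∖-elim {X = X₁ ∩ X₂} X∖x
        in cong₂ _∧_ (neighbours-intro (Bool.∧-conicalˡ _ _ X₁₂x′) (deleteEdge-keeps (inj₁ x′≢x) Ex′y))
                     (neighbours-intro (Bool.∧-conicalʳ _ _ X₁₂x′) (deleteEdge-keeps (inj₁ x′≢x) Ex′y))

      hall-∪ : count (X₁ ∪ X₂) ≤ count (N₁ ∪ N₂)
      hall-∪ = ≤-trans (hall (X₁ ∪ X₂)) (count-mono (neighbours-⊆ union-edge))

      hall-∩ : count ((X₁ ∩ X₂) ∖ x) ≤ count (N₁ ∩ N₂)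
      hall-∩ = ≤-trans (hall ((X₁ ∩ X₂) ∖ x)) (count-mono (neighbours-⊆ inter-edge))

  rado : ∀ {E x y₁ y₂} → HallCondition E → y₁ ≢ y₂ → E x y₁ ≡ true → E x y₂ ≡ true →
         ∃ λ y → E x y ≡ true × HallCondition (deleteEdge E x y)
  rado {E} {x} {y₁} {y₂} hall y₁≢y₂ e₁ e₂ with hall? (deleteEdge E x y₁) | hall? (deleteEdge E x y₂)
  ... | inj₁ hall₁    | _             = y₁ , e₁ , hall₁
  ... | inj₂ _        | inj₁ hall₂    = y₂ , e₂ , hall₂
  ... | inj₂ (_ , v₁) | inj₂ (_ , v₂) = ⊥-elim (no-two-violators hall y₁≢y₂ v₁ v₂)

  deg≤1⇒matching : ∀ {E} → HallCondition E → (∀ x → deg E x ≤ 1) → Matching E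
  deg≤1⇒matching {E} hall deg≤1 = record { mate = mate ; mate-edge = mate-edge ; mate-injective = injective }
    where
      has-neighbour : ∀ x → 0 < deg E x
      has-neighbour x = begin-strict
        0                             <⟨ s≤s z≤n ⟩
        1                             ≡⟨ count-singleton x ⟨
        count (_== x)                 ≤⟨ hall (_== x) ⟩
        count (neighbours E (_== x))  ≤⟨ count-mono (neighbours-⊆ edge-from-x) ⟩
        deg E x                       ∎
        where
          open ≤-Reasoning
          edge-from-x : ∀ {x′ y} → (x′ == x) ≡ true → E x′ y ≡ true → E x y ≡ true
          edge-from-x x′==x Ex′y = subst (λ z → E z _ ≡ true) (==⇒≡ x′==x) Ex′y

      mate : Fin a → Fin b
      mate x = proj₁ (count-witness {X = E x} (has-neighbour x))

      mate-edge : ∀ x → E x (mate x) ≡ true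
      mate-edge x = proj₂ (count-witness {X = E x} (has-neighbour x))

      only-neighbour : ∀ {x y} → E x y ≡ true → y ≡ mate x
      only-neighbour {x} Exy = count≤1⇒unique {X = E x} (deg≤1 x) Exy (mate-edge x)

      injective : Injective _≡_ _≡_ mate
      injective {x} {x′} same with x ≟ x′
      ... | yes x≡x′ = x≡x′
      ... | no  x≢x′ = contradiction (begin
        2                          ≤⟨ count-pair x≢x′ (∪-introˡ {X = _== x} {_== x′} {x} (==-refl x))
                                                      (∪-introʳ {X = _== x} {_== x′} {x′} (==-refl x′)) ⟩
        count pair                 ≤⟨ hall pair ⟩
        count (neighbours E pair)  ≤⟨ count-mono (neighbours-⊆ into-mate) ⟩
        count (_== mate x)         ≡⟨ count-singleton (mate x) ⟩
        1                          ∎) (1+n≰n {1})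
        where
          open ≤-Reasoning
          pair = (_== x) ∪ (_== x′)

          into-mate : ∀ {z y} → pair z ≡ true → E z y ≡ true → (y == mate x) ≡ true
          into-mate {z} z∈pair Ezy with ∨-true (z == x) (z == x′) z∈pair
          ... | inj₁ z==x  = ≡⇒== (trans (only-neighbour Ezy) (cong mate (==⇒≡ z==x)))
          ... | inj₂ z==x′ = ≡⇒== (trans (only-neighbour Ezy) (trans (cong mate (==⇒≡ z==x′)) (sym same)))

  hall-induction : ∀ k {E} → edgeCount E < k → HallCondition E → Matching E
  hall-induction (suc k) {E} bound hall with any? (λ x → 2 ≤? deg E x)
  ... | no  no-big      = deg≤1⇒matching hall (λ x → s≤s⁻¹ (≰⇒> (no-big ∘ (x ,_))))
  ... | yes (x , big) =
    let y₁ , y₂ , y₁≢y₂ , e₁ , e₂ = count≥2⇒pair big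
        y , e , hall′              = rado hall y₁≢y₂ e₁ e₂
    in Matching-mono (deleteEdge-⊆ E x y) (hall-induction k (<-≤-trans (edgeCount-deleteEdge e) (s≤s⁻¹ bound)) hall′)

  hall-theorem : ∀ {E} → HallCondition E → Matching E
  hall-theorem {E} = hall-induction (suc (edgeCount E)) ≤-refl

  regular⇒HallCondition : ∀ {E r} .{{_ : NonZero r}} → (∀ x → deg E x ≡ r) → (∀ y → codeg E y ≤ r) → HallCondition E
  regular⇒HallCondition {E} {r} deg≡r codeg≤r X = *-cancelʳ-≤ (count X) (count (neighbours E X)) r (begin
    count X * r                             ≡⟨ cong (_* r) (count≡sum X) ⟩
    sum (ind ∘ X) * r                       ≡⟨ *-distribʳ-sum r (ind ∘ X) ⟩
    sum (λ x → ind (X x) * r)               ≡⟨ sum-cong-≗ row ⟩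
    sum (λ x → count (λ y → X x ∧ E x y))   ≡⟨ count-swap (λ x y → X x ∧ E x y) ⟩
    sum (λ y → count (λ x → X x ∧ E x y))   ≤⟨ sum-mono column ⟩
    sum (λ y → ind (neighbours E X y) * r)  ≡⟨ *-distribʳ-sum r (ind ∘ neighbours E X) ⟨
    sum (ind ∘ neighbours E X) * r          ≡⟨ cong (_* r) (count≡sum (neighbours E X)) ⟨
    count (neighbours E X) * r              ∎)
    where
      open ≤-Reasoning
      row : ∀ x → ind (X x) * r ≡ count (λ y → X x ∧ E x y)
      row x with X x
      ... | true  = trans (*-identityˡ r) (sym (deg≡r x))
      ... | false = sym (count-none {b} {λ _ → false} λ _ → refl)

      column : ∀ y → count (λ x → X x ∧ E x y) ≤ ind (neighbours E X y) * r
      column y with neighbours E X y in N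
      ... | true  = ≤-trans (count-mono {X = λ x → X x ∧ E x y} (λ x → Bool.∧-conicalʳ (X x) _))
                            (≤-trans (codeg≤r y) (≤-reflexive (sym (*-identityˡ r))))
      ... | false = ≤-reflexive (count-none {X = λ x → X x ∧ E x y} λ x → Bool.¬-not λ XEx → contradiction
                      (trans (sym N) (neighbours-intro (Bool.∧-conicalˡ _ _ XEx) (Bool.∧-conicalʳ _ _ XEx))) λ ())

-- König's theorem for regular bipartite graphs

module _ {a b : ℕ} where

  record Decomposition (r : ℕ) (E : BipGraph a b) : Set where
    field
      matching : Fin r → Matching E
      covers   : ∀ {x y} → E x y ≡ true → count (λ k → y == Matching.mate (matching k) x) ≡ 1

  konig : ∀ r {E : BipGraph a b} → (∀ x → deg E x ≡ r) → (∀ y → codeg E y ≡ r) → Decomposition r E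
  konig zero {E} deg≡0 _ = record
    { matching = λ ()
    ; covers   = λ {x} Exy → contradiction (subst (0 <_) (deg≡0 x) (count-pos {X = E x} Exy)) λ ()
    }
  konig (suc r) {E} deg≡1+r codeg≡1+r = record { matching = matching ; covers = covers }
    where
      M : Matching E
      M = hall-theorem (regular⇒HallCondition deg≡1+r (≤-reflexive ∘ codeg≡1+r))
      open Matching M

      -- The transposed graph is regular too, so it has a matching Fin b → Fin a; hence M is a bijection.
      b≤a : b ≤ a
      b≤a = injective⇒≤ (Matching.mate-injective
              (hall-theorem {E = λ y x → E x y} (regular⇒HallCondition codeg≡1+r (≤-reflexive ∘ deg≡1+r))))

      E′ : BipGraph a b
      E′ x = E x ∖ mate x

      E′⊆E : E′ ⊆E E
      E′⊆E x y = Bool.∧-conicalʳ _ _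

      deg-E′ : ∀ x → deg E′ x ≡ r
      deg-E′ x = suc-injective (trans (sym (count-remove-∈ (E x) (mate-edge x))) (deg≡1+r x))

      column-E′ : ∀ x₀ → (λ x → E′ x (mate x₀)) ≗ (λ x → E x (mate x₀)) ∖ x₀
      column-E′ x₀ x = cong (λ c → not c ∧ E x (mate x₀)) (bool-antisym
        (λ same-mate → ≡⇒== (mate-injective (sym (==⇒≡ same-mate))))
        (λ x==x₀ → ≡⇒== (cong mate (sym (==⇒≡ x==x₀)))))

      codeg-E′ : ∀ y → codeg E′ y ≡ r
      codeg-E′ y with injective⇒surjective mate-injective b≤a y
      ... | x₀ , refl = suc-injective (begin
        suc (codeg E′ (mate x₀))                  ≡⟨ cong suc (count-cong (column-E′ x₀)) ⟩
        suc (count ((λ x → E x (mate x₀)) ∖ x₀))  ≡⟨ count-remove-∈ (λ x → E x (mate x₀)) (mate-edge x₀) ⟨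
        codeg E (mate x₀)                         ≡⟨ codeg≡1+r (mate x₀) ⟩
        suc r                                     ∎)
        where open ≡-Reasoning

      module D′ = Decomposition (konig r deg-E′ codeg-E′)

      matching : Fin (suc r) → Matching E
      matching Fin.zero    = M
      matching (Fin.suc k) = Matching-mono E′⊆E (D′.matching k)

      covers : ∀ {x y} → E x y ≡ true → count (λ k → y == Matching.mate (matching k) x) ≡ 1
      covers {x} {y} Exy with y ≟ mate x
      ... | yes refl   = cong suc (count-none λ k →
                           ≢⇒==false (proj₁ (∖-elim {X = E x} (Matching.mate-edge (D′.matching k) x)) ∘ sym))
      ... | no  y≢mate = D′.covers (∖-intro {X = E x} y≢mate Exy)

-- Windows and periodicity

extend : ∀ {n} → (Fin n → Bool) → ℕ → Bool
extend {zero}  g _       = false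
extend {suc n} g zero    = g Fin.zero
extend {suc n} g (suc j) = extend (g ∘ Fin.suc) j

extend-toℕ : ∀ {n} (g : Fin n → Bool) s → extend g (toℕ s) ≡ g s
extend-toℕ g Fin.zero    = refl
extend-toℕ g (Fin.suc s) = extend-toℕ (g ∘ Fin.suc) s

windowCount : (ℕ → Bool) → ℕ → ℕ → ℕ
windowCount h i zero    = 0
windowCount h i (suc d) = ind (h i) + windowCount h (suc i) d

windowCount-false : ∀ i d → windowCount (λ _ → false) i d ≡ 0
windowCount-false i zero    = refl
windowCount-false i (suc d) = windowCount-false (suc i) d

windowCount-shift : ∀ h i d → windowCount h (suc i) d ≡ windowCount (h ∘ suc) i d
windowCount-shift h i zero    = refl
windowCount-shift h i (suc d) = cong (ind (h (suc i)) +_) (windowCount-shift h (suc i) d)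

windowCount-snoc : ∀ h i d → windowCount h i (suc d) ≡ windowCount h i d + ind (h (i + d))
windowCount-snoc h i zero    = trans (+-identityʳ (ind (h i))) (cong (ind ∘ h) (sym (+-identityʳ i)))
windowCount-snoc h i (suc d) = begin
  ind (h i) + W (suc d)                    ≡⟨ cong (ind (h i) +_) (windowCount-snoc h (suc i) d) ⟩
  ind (h i) + (W d + ind (h (suc i + d)))  ≡⟨ +-assoc (ind (h i)) _ _ ⟨
  ind (h i) + W d + ind (h (suc i + d))    ≡⟨ cong (λ j → ind (h i) + W d + ind (h j)) (+-suc i d) ⟨
  ind (h i) + W d + ind (h (i + suc d))    ∎
  where
    open ≡-Reasoning
    W = windowCount h (suc i)

windowCount-period : ∀ h i d → windowCount h i d ≡ windowCount h (suc i) d → h i ≡ h (i + d)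
windowCount-period h i d same = ind-injective (+-cancelˡ-≡ (windowCount h i d) _ _ (begin
  windowCount h i d + ind (h i)        ≡⟨ +-comm (windowCount h i d) _ ⟩
  ind (h i) + windowCount h i d        ≡⟨ cong (ind (h i) +_) same ⟩
  windowCount h i (suc d)              ≡⟨ windowCount-snoc h i d ⟩
  windowCount h i d + ind (h (i + d))  ∎))
  where open ≡-Reasoning

<ᵇ-suc : ∀ i j → (i <ᵇ suc j) ≡ (i ≤ᵇ j)
<ᵇ-suc zero    j = refl
<ᵇ-suc (suc i) j = refl

count-window : ∀ {n} (g : Fin n → Bool) i d →
               count (λ s → ((i ≤ᵇ toℕ s) ∧ (toℕ s <ᵇ i + d)) ∧ g s) ≡ windowCount (extend g) i d
count-window {zero}  g i       d       = sym (windowCount-false i d)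
count-window {suc n} g zero    zero    = count-none {X = λ s → false ∧ g s} λ _ → refl
count-window {suc n} g zero    (suc d) =
  cong (ind (g Fin.zero) +_) (trans (count-window (g ∘ Fin.suc) 0 d) (sym (windowCount-shift (extend g) 0 d)))
count-window {suc n} g (suc i) d       = begin
  count (λ s → ((i <ᵇ suc (toℕ s)) ∧ (toℕ s <ᵇ i + d)) ∧ g (Fin.suc s))
    ≡⟨ count-cong (λ s → cong (λ b → (b ∧ (toℕ s <ᵇ i + d)) ∧ g (Fin.suc s)) (<ᵇ-suc i (toℕ s))) ⟩
  count (λ s → ((i ≤ᵇ toℕ s) ∧ (toℕ s <ᵇ i + d)) ∧ g (Fin.suc s))
    ≡⟨ count-window (g ∘ Fin.suc) i d ⟩
  windowCount (extend (g ∘ Fin.suc)) i d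
    ≡⟨ windowCount-shift (extend g) i d ⟨
  windowCount (extend g) (suc i) d
    ∎
  where open ≡-Reasoning

count-prefix : ∀ {n d} (d≤n : d ≤ n) (g : Fin n → Bool) →
               count (λ s → (toℕ s <ᵇ d) ∧ g s) ≡ count (λ c → g (inject≤ c d≤n))
count-prefix {zero}  {zero}  _   g = refl
count-prefix {suc n} {zero}  _   g = count-none {X = λ s → false ∧ g s} λ _ → refl
count-prefix {suc n} {suc d} d≤n g = cong (ind (g Fin.zero) +_) (count-prefix (s≤s⁻¹ d≤n) (g ∘ Fin.suc))

periodic⇒mod : ∀ {A : Set} (h : ℕ → A) n d .{{_ : NonZero d}} →
               (∀ j → j + d < n → h j ≡ h (j + d)) → ∀ j → j < n → h j ≡ h (j % d)
periodic⇒mod h n d period j j<n = begin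
  h j                      ≡⟨ cong h (m≡m%n+[m/n]*n j d) ⟩
  h (j % d + (j / d) * d)  ≡⟨ repeat (j / d) (j % d) (subst (_< n) (m≡m%n+[m/n]*n j d) j<n) ⟨
  h (j % d)                ∎
  where
    open ≡-Reasoning
    repeat : ∀ q i → i + q * d < n → h i ≡ h (i + q * d)
    repeat zero    i _     = cong h (sym (+-identityʳ i))
    repeat (suc q) i bound =
      trans (repeat q i (≤-<-trans (m≤m+n _ d) bound′)) (trans (period (i + q * d) bound′) (cong h step))
      where
        step : i + q * d + d ≡ i + suc q * d
        step = trans (+-assoc i (q * d) d) (cong (i +_) (+-comm (q * d) d))
        bound′ : i + q * d + d < n
        bound′ = subst (_< n) (sym step) bound

windowDeg-periodic : ∀ {n m r} (E : BipGraph n m) d .{{_ : NonZero d}} →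
                     (∀ t i → i + d ≤ n → windowDeg E d i t ≡ r) →
                     ∀ {s s₀} → toℕ s₀ ≡ toℕ s % d → ∀ t → E s t ≡ E s₀ t
windowDeg-periodic {n} {r = r} E d window≡r {s} {s₀} s₀≡s%d t = begin
  E s t                      ≡⟨ extend-toℕ column s ⟨
  extend column (toℕ s)      ≡⟨ periodic⇒mod (extend column) n d shift (toℕ s) (toℕ<n s) ⟩
  extend column (toℕ s % d)  ≡⟨ cong (extend column) s₀≡s%d ⟨
  extend column (toℕ s₀)     ≡⟨ extend-toℕ column s₀ ⟩
  E s₀ t                     ∎
  where
    open ≡-Reasoning
    column = λ s → E s t

    window : ∀ i → i + d ≤ n → windowCount (extend column) i d ≡ r
    window i bound = trans (sym (count-window column i d)) (window≡r t i bound)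

    shift : ∀ j → j + d < n → extend column j ≡ extend column (j + d)
    shift j bound = windowCount-period (extend column) j d (trans (window j (<⇒≤ bound)) (sym (window (suc j) bound)))

¬regular-width-0 : ∀ {n m r} (E : BipGraph (suc n) m) → r ≥ 1 → ¬ IsRegular E 0 r
¬regular-width-0 E r≥1 (deg≡r , window≡r) =
  let t , _ = count-witness {X = E Fin.zero} (subst (1 ≤_) (sym (deg≡r Fin.zero)) r≥1)
  in >⇒≢ r≥1 (trans (sym (window≡r t 0 z≤n)) (count-none {X = λ s → false ∧ E s t} λ _ → refl))

%-≡⇒∣∸ : ∀ d .{{_ : NonZero d}} u v → u % d ≡ v % d → d ∣ v ∸ u
%-≡⇒∣∸ d u v same = divides (v / d ∸ u / d) (begin
  v ∸ u                                      ≡⟨ cong₂ _∸_ (m≡m%n+[m/n]*n v d) (m≡m%n+[m/n]*n u d) ⟩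
  (v % d + v / d * d) ∸ (u % d + u / d * d)  ≡⟨ cong (λ c → (v % d + v / d * d) ∸ (c + u / d * d)) same ⟩
  (v % d + v / d * d) ∸ (v % d + u / d * d)  ≡⟨ [m+n]∸[m+o]≡n∸o (v % d) _ _ ⟩
  v / d * d ∸ u / d * d                      ≡⟨ *-distribʳ-∸ d (v / d) (u / d) ⟨
  (v / d ∸ u / d) * d                        ∎)
  where open ≡-Reasoning

%-≡⇒∣∣-∣ : ∀ d .{{_ : NonZero d}} u v → u % d ≡ v % d → d ∣ ∣ u - v ∣
%-≡⇒∣∣-∣ d u v same with ≤-total u v
... | inj₁ u≤v = subst (d ∣_) (sym (m≤n⇒∣m-n∣≡n∸m u≤v)) (%-≡⇒∣∸ d u v same)
... | inj₂ v≤u = subst (d ∣_) (sym (m≤n⇒∣n-m∣≡n∸m v≤u)) (%-≡⇒∣∸ d v u (sym same))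

%-≡⇒≤∣-∣ : ∀ d .{{_ : NonZero d}} {u v} → u % d ≡ v % d → u ≢ v → d ≤ ∣ u - v ∣
%-≡⇒≤∣-∣ d {u} {v} same u≢v = ∣⇒≤ {{≢-nonZero (u≢v ∘ ∣m-n∣≡0⇒m≡n)}} (%-≡⇒∣∣-∣ d u v same)

pullback-partition : ∀ {n m c d r} {E : BipGraph n m} {H : BipGraph c m} (ρ : Fin n → Fin c) →
                     (∀ s t → E s t ≡ H (ρ s) t) →
                     (∀ {s s′} → ρ s ≡ ρ s′ → s ≢ s′ → d ≤ ∣ toℕ s - toℕ s′ ∣) →
                     Decomposition r H → PartitionInto d r E
pullback-partition {n} {m} {d = d} {r} {E} {H} ρ E≡H spread D = M , M⊆E , M-covers , λ k → M-perfect k , M-spread k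
  where
    open Decomposition D
    open Matching

    M : Fin r → EdgeSet n m
    M k s t = t == mate (matching k) (ρ s)

    M⊆E : ∀ k → M k ⊆E E
    M⊆E k s t t==mate =
      trans (E≡H s t) (subst (λ z → H (ρ s) z ≡ true) (sym (==⇒≡ t==mate)) (mate-edge (matching k) (ρ s)))

    M-covers : ∀ s t → E s t ≡ true → count (λ k → M k s t) ≡ 1
    M-covers s t Est = covers (trans (sym (E≡H s t)) Est)

    M-perfect : ∀ k s → count (λ t → M k s t) ≡ 1
    M-perfect k s = count-singleton (mate (matching k) (ρ s))

    M-spread : ∀ k s s′ t → M k s t ≡ true → M k s′ t ≡ true → s ≢ s′ → d ≤ ∣ toℕ s - toℕ s′ ∣
    M-spread k s s′ t Mst Ms′t =
      spread (mate-injective (matching k) (trans (sym (==⇒≡ {i = t} Mst)) (==⇒≡ {i = t} Ms′t)))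

corollary3 : (n m d r : ℕ) → (E : BipGraph n m) →
    n ≥ d → r ≥ 1 → IsRegular E d r → PartitionInto d r E
corollary3 zero    m zero      r E _   _   _       = (λ _ ()) , (λ _ ()) , (λ ()) , λ _ → (λ ()) , λ ()
corollary3 (suc n) m zero      r E _   r≥1 regular = contradiction regular (¬regular-width-0 E r≥1)
corollary3 n       m d@(suc _) r E n≥d _   (deg≡r , window≡r) =
  pullback-partition residue periodic spread (konig r {H} (deg≡r ∘ first) codeg-H)
  where
    first : Fin d → Fin n
    first c = inject≤ c n≥d

    H : BipGraph d m
    H c = E (first c)

    codeg-H : ∀ t → codeg H t ≡ r
    codeg-H t = trans (sym (count-prefix n≥d (λ s → E s t))) (window≡r t 0 n≥d)

    residue : Fin n → Fin d
    residue s = toℕ s mod d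

    toℕ-residue : ∀ s → toℕ (residue s) ≡ toℕ s % d
    toℕ-residue s = toℕ-fromℕ< _

    periodic : ∀ s t → E s t ≡ H (residue s) t
    periodic s = windowDeg-periodic E d window≡r (trans (toℕ-inject≤ (residue s) n≥d) (toℕ-residue s))

    spread : ∀ {s s′} → residue s ≡ residue s′ → s ≢ s′ → d ≤ ∣ toℕ s - toℕ s′ ∣
    spread {s} {s′} same s≢s′ =
      %-≡⇒≤∣-∣ d (trans (sym (toℕ-residue s)) (trans (cong toℕ same) (toℕ-residue s′))) (s≢s′ ∘ toℕ-injective)
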